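{- Let $a$ and $b$ be coprime integers and let $\ell \in G_{(a,b)}$. If $\ell\notin\{1,2\}$, then all integers $k \in \mathcal{K}_{(a,b)}(\ell)$ have the same parity.
   Context: For coprime nonzero integers $a,b$, a positive integer $\ell$ is called good with respect to $a$ and $b$ if there is a positive integer $k$ with $\ell \mid (a^k+b^k)$; $G_{(a,b)}$ denotes the set of such good integers, and for $\ell\in G_{(a,b)}$, $\mathcal{K}_{(a,b)}(\ell)=\{k\in\mathbb{N} : \ell \mid (a^k+b^k)\}$ ($\mathbb{N}$ = positive integers). -}

module Defs where

open import Data.Nat using (ℕ; zero; suc)
open import Data.Integer using (ℤ; +_; _+_; _^_)
open import Data.Integer.Divisibility using (_∣_)
open import Data.Product using (∃; _×_)

InK : ℤ → ℤ → ℕ → ℕ → Set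
InK a b ℓ k = (k Data.Nat.> 0) × (+ ℓ ∣ a ^ k + b ^ k)

Good : ℤ → ℤ → ℕ → Set
Good a b ℓ = (ℓ Data.Nat.> 0) × ∃ λ k → InK a b ℓ k

{-# OPTIONS --safe #-}
-- If k is odd and k′ even, put N = k k′. Since a^k ≡ -b^k (mod ℓ), raising to the even power
-- k′ gives ℓ ∣ a^N - b^N; since a^k′ ≡ -b^k′, raising to the odd power k gives ℓ ∣ a^N + b^N.
-- Hence ℓ divides both 2a^N and 2b^N, and so ℓ ∣ 2 because a^N and b^N are coprime.
module Submission where

open import Defs
open import Data.Nat using (ℕ; _%_)
open import Data.Integer using (ℤ; 0ℤ)
open import Data.Integer.Coprimality using (Coprime)
open import Relation.Binary.PropositionalEquality using (_≡_; _≢_)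

open import Data.Nat.Base as ℕ using (zero; suc; _/_)
import Data.Nat.Properties as ℕ
open import Data.Nat.DivMod using (m≡m%n+[m/n]*n; m%n<n)
import Data.Nat.Divisibility as ℕ
import Data.Nat.Coprimality as ℕ
open import Data.Nat.Primality using (irreducible[2])
open import Data.Integer.Base using (+_; -_; _+_; _-_; _*_; _^_; ∣_∣)
open import Data.Integer.Properties using (abs-*; ^-*-assoc; neg-involutive; neg-distribˡ-*)
open import Data.Integer.Divisibility.Signed
  using (_∣_; divides; ∣-refl; ∣-trans; ∣ᵤ⇒∣; ∣⇒∣ᵤ; ∣m∣n⇒∣m+n; ∣m∣n⇒∣m-n; ∣n⇒∣m*n; ∣m⇒∣m*n)
open import Data.Integer.Tactic.RingSolver using (solve-∀)
open import Data.Product.Base using (_,_)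
open import Data.Sum.Base using (_⊎_; inj₁; inj₂; [_,_]′)
open import Data.Empty using (⊥-elim)
open import Relation.Binary.PropositionalEquality
  using (refl; sym; trans; cong; cong₂; subst; module ≡-Reasoning)

open ≡-Reasoning

coprime-* : ∀ {m n o} → ℕ.Coprime m n → ℕ.Coprime m o → ℕ.Coprime m (n ℕ.* o)
coprime-* m⊥n m⊥o (d∣m , d∣no) =
  m⊥o (d∣m , ℕ.coprime-divisor (λ (e∣d , e∣n) → m⊥n (ℕ.∣-trans e∣d d∣m , e∣n)) d∣no)

coprime-^ʳ : ∀ {m n} k → ℕ.Coprime m n → ℕ.Coprime m (n ℕ.^ k)
coprime-^ʳ {m} zero    _   = ℕ.sym (ℕ.1-coprimeTo m)
coprime-^ʳ     (suc k) m⊥n = coprime-* m⊥n (coprime-^ʳ k m⊥n)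

coprime-^ : ∀ {m n} i j → ℕ.Coprime m n → ℕ.Coprime (m ℕ.^ i) (n ℕ.^ j)
coprime-^ i j m⊥n = ℕ.sym (coprime-^ʳ i (ℕ.sym (coprime-^ʳ j m⊥n)))

abs-^ : ∀ i n → ∣ i ^ n ∣ ≡ ∣ i ∣ ℕ.^ n
abs-^ i zero    = refl
abs-^ i (suc n) = trans (abs-* i (i ^ n)) (cong (∣ i ∣ ℕ.*_) (abs-^ i n))

m%2≡0⊎m%2≡1 : ∀ m → m % 2 ≡ 0 ⊎ m % 2 ≡ 1
m%2≡0⊎m%2≡1 m with m % 2 | m%n<n m 2
... | 0           | _                  = inj₁ refl
... | 1           | _                  = inj₂ refl
... | suc (suc _) | ℕ.s≤s (ℕ.s≤s ())

[-i]^[q*2]≡i^[q*2] : ∀ i q → (- i) ^ (q ℕ.* 2) ≡ i ^ (q ℕ.* 2)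
[-i]^[q*2]≡i^[q*2] i zero    = refl
[-i]^[q*2]≡i^[q*2] i (suc q) = begin
  - i * (- i * (- i) ^ (q ℕ.* 2)) ≡⟨ cong (λ j → - i * (- i * j)) ([-i]^[q*2]≡i^[q*2] i q) ⟩
  - i * (- i * i ^ (q ℕ.* 2))     ≡⟨ -x*[-x*y]≡x*[x*y] i (i ^ (q ℕ.* 2)) ⟩
  i * (i * i ^ (q ℕ.* 2))         ∎
  where
  -x*[-x*y]≡x*[x*y] : ∀ x y → - x * (- x * y) ≡ x * (x * y)
  -x*[-x*y]≡x*[x*y] = solve-∀

[-i]^n≡i^n : ∀ i n → n % 2 ≡ 0 → (- i) ^ n ≡ i ^ n
[-i]^n≡i^n i n n-even = subst (λ m → (- i) ^ m ≡ i ^ m) (sym n≡[n/2]*2) ([-i]^[q*2]≡i^[q*2] i (n / 2))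
  where
  n≡[n/2]*2 : n ≡ n / 2 ℕ.* 2
  n≡[n/2]*2 = trans (m≡m%n+[m/n]*n n 2) (cong (ℕ._+ n / 2 ℕ.* 2) n-even)

[-i]^n≡-i^n : ∀ i n → n % 2 ≡ 1 → (- i) ^ n ≡ - i ^ n
[-i]^n≡-i^n i n n-odd = subst (λ m → (- i) ^ m ≡ - i ^ m) (sym n≡1+[n/2]*2) (begin
  - i * (- i) ^ (n / 2 ℕ.* 2) ≡⟨ cong (- i *_) ([-i]^[q*2]≡i^[q*2] i (n / 2)) ⟩
  - i * i ^ (n / 2 ℕ.* 2)     ≡⟨ neg-distribˡ-* i _ ⟨
  - (i * i ^ (n / 2 ℕ.* 2))   ∎)
  where
  n≡1+[n/2]*2 : n ≡ suc (n / 2 ℕ.* 2)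
  n≡1+[n/2]*2 = trans (m≡m%n+[m/n]*n n 2) (cong (ℕ._+ n / 2 ℕ.* 2) n-odd)

x-y∣xⁿ-yⁿ : ∀ x y n → x - y ∣ x ^ n - y ^ n
x-y∣xⁿ-yⁿ x y zero    = divides 0ℤ refl
x-y∣xⁿ-yⁿ x y (suc n) = subst (x - y ∣_) (x*[p-q]+[x-y]*q≡x*p-y*q x y (x ^ n) (y ^ n))
  (∣m∣n⇒∣m+n (∣n⇒∣m*n x (x-y∣xⁿ-yⁿ x y n)) (∣m⇒∣m*n (y ^ n) ∣-refl))
  where
  x*[p-q]+[x-y]*q≡x*p-y*q : ∀ x y p q → x * (p - q) + (x - y) * q ≡ x * p - y * q
  x*[p-q]+[x-y]*q≡x*p-y*q = solve-∀

x+y∣xⁿ-[-y]ⁿ : ∀ x y n → x + y ∣ x ^ n - (- y) ^ n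
x+y∣xⁿ-[-y]ⁿ x y n = subst (λ z → x + z ∣ x ^ n - (- y) ^ n) (neg-involutive y) (x-y∣xⁿ-yⁿ x (- y) n)

x+y∣xⁿ-yⁿ : ∀ x y n → n % 2 ≡ 0 → x + y ∣ x ^ n - y ^ n
x+y∣xⁿ-yⁿ x y n n-even =
  subst (λ z → x + y ∣ x ^ n - z) ([-i]^n≡i^n y n n-even) (x+y∣xⁿ-[-y]ⁿ x y n)

x+y∣xⁿ+yⁿ : ∀ x y n → n % 2 ≡ 1 → x + y ∣ x ^ n + y ^ n
x+y∣xⁿ+yⁿ x y n n-odd = subst (x + y ∣_) (begin
  x ^ n - (- y) ^ n ≡⟨ cong (λ z → x ^ n - z) ([-i]^n≡-i^n y n n-odd) ⟩
  x ^ n - - y ^ n   ≡⟨ cong (λ z → x ^ n + z) (neg-involutive (y ^ n)) ⟩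
  x ^ n + y ^ n     ∎) (x+y∣xⁿ-[-y]ⁿ x y n)

∣odd-and-even-power-sums⇒∣2 : ∀ d a b k k′ → Coprime a b → k % 2 ≡ 1 → k′ % 2 ≡ 0 →
                              d ∣ a ^ k + b ^ k → d ∣ a ^ k′ + b ^ k′ → ∣ d ∣ ℕ.∣ 2
∣odd-and-even-power-sums⇒∣2 d a b k k′ a⊥b k-odd k′-even d∣sₖ d∣sₖ′ =
  ℕ.coprime-factors (coprime-^ N N a⊥b) (∣i^N*2⇒∣∣i∣^N*2 a d∣aᴺ*2 , ∣i^N*2⇒∣∣i∣^N*2 b d∣bᴺ*2)
  where
  N : ℕ
  N = k ℕ.* k′

  [iᵏ′]ᵏ≡iᴺ : ∀ i → (i ^ k′) ^ k ≡ i ^ N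
  [iᵏ′]ᵏ≡iᴺ i = trans (^-*-assoc i k′ k) (cong (i ^_) (ℕ.*-comm k′ k))

  d∣aᴺ-bᴺ : d ∣ a ^ N - b ^ N
  d∣aᴺ-bᴺ = ∣-trans d∣sₖ (subst (a ^ k + b ^ k ∣_) (cong₂ _-_ (^-*-assoc a k k′) (^-*-assoc b k k′))
                                 (x+y∣xⁿ-yⁿ (a ^ k) (b ^ k) k′ k′-even))

  d∣aᴺ+bᴺ : d ∣ a ^ N + b ^ N
  d∣aᴺ+bᴺ = ∣-trans d∣sₖ′ (subst (a ^ k′ + b ^ k′ ∣_) (cong₂ _+_ ([iᵏ′]ᵏ≡iᴺ a) ([iᵏ′]ᵏ≡iᴺ b))
                                  (x+y∣xⁿ+yⁿ (a ^ k′) (b ^ k′) k k-odd))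

  [p+q]+[p-q]≡p*2 : ∀ p q → (p + q) + (p - q) ≡ p * + 2
  [p+q]+[p-q]≡p*2 = solve-∀

  [p+q]-[p-q]≡q*2 : ∀ p q → (p + q) - (p - q) ≡ q * + 2
  [p+q]-[p-q]≡q*2 = solve-∀

  d∣aᴺ*2 : d ∣ a ^ N * + 2
  d∣aᴺ*2 = subst (d ∣_) ([p+q]+[p-q]≡p*2 (a ^ N) (b ^ N)) (∣m∣n⇒∣m+n d∣aᴺ+bᴺ d∣aᴺ-bᴺ)

  d∣bᴺ*2 : d ∣ b ^ N * + 2
  d∣bᴺ*2 = subst (d ∣_) ([p+q]-[p-q]≡q*2 (a ^ N) (b ^ N)) (∣m∣n⇒∣m-n d∣aᴺ+bᴺ d∣aᴺ-bᴺ)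

  ∣i^N*2⇒∣∣i∣^N*2 : ∀ i → d ∣ i ^ N * + 2 → ∣ d ∣ ℕ.∣ ∣ i ∣ ℕ.^ N ℕ.* 2
  ∣i^N*2⇒∣∣i∣^N*2 i d∣iᴺ*2 =
    subst (∣ d ∣ ℕ.∣_) (trans (abs-* (i ^ N) (+ 2)) (cong (ℕ._* 2) (abs-^ i N))) (∣⇒∣ᵤ d∣iᴺ*2)

lemma2p12 : (a b : ℤ) → a ≢ 0ℤ → b ≢ 0ℤ → Coprime a b →
    (ℓ : ℕ) → Good a b ℓ → ℓ ≢ 1 → ℓ ≢ 2 →
    (k k′ : ℕ) → InK a b ℓ k → InK a b ℓ k′ → k % 2 ≡ k′ % 2
lemma2p12 a b _ _ a⊥b ℓ _ ℓ≢1 ℓ≢2 k k′ (_ , ℓ∣sₖ) (_ , ℓ∣sₖ′)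
  with m%2≡0⊎m%2≡1 k | m%2≡0⊎m%2≡1 k′
... | inj₁ k-even | inj₁ k′-even = trans k-even (sym k′-even)
... | inj₂ k-odd  | inj₂ k′-odd  = trans k-odd (sym k′-odd)
... | inj₂ k-odd  | inj₁ k′-even = ⊥-elim ([ ℓ≢1 , ℓ≢2 ]′ (irreducible[2]
  (∣odd-and-even-power-sums⇒∣2 (+ ℓ) a b k k′ a⊥b k-odd k′-even (∣ᵤ⇒∣ ℓ∣sₖ) (∣ᵤ⇒∣ ℓ∣sₖ′))))
... | inj₁ k-even | inj₂ k′-odd  = ⊥-elim ([ ℓ≢1 , ℓ≢2 ]′ (irreducible[2]
  (∣odd-and-even-power-sums⇒∣2 (+ ℓ) a b k′ k a⊥b k′-odd k-even (∣ᵤ⇒∣ ℓ∣sₖ′) (∣ᵤ⇒∣ ℓ∣sₖ))))
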